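{- Let $\Lambda=(\mathcal{L},\mathfrak{M},\models)$ be an eviction-compatible satisfaction system and let $\ominus:\mathcal{P}_{\mathrm{fin}}(\mathcal{L})\times\mathcal{P}(\mathfrak{M})\to\mathcal{P}_{\mathrm{fin}}(\mathcal{L})$ be a model change operation. Then there exists a selection function $\gamma$ on $\Lambda$ such that $\mathrm{Mod}(\ominus(B,\mathbb{M}))=\gamma(\mathrm{FRsubs}(\mathrm{Mod}(B)\setminus\mathbb{M},\Lambda))$ for all $B\in\mathcal{P}_{\mathrm{fin}}(\mathcal{L})$ and $\mathbb{M}\subseteq\mathfrak{M}$ (i.e. $\ominus$ is a maxichoice eviction function) if and only if $\ominus$ satisfies, for all $B,B'\in\mathcal{P}_{\mathrm{fin}}(\mathcal{L})$ and $\mathbb{M},\mathbb{M}'\subseteq\mathfrak{M}$: (success) $\mathbb{M}\cap\mathrm{Mod}(\ominus(B,\mathbb{M}))=\emptyset$; (inclusion) $\mathrm{Mod}(\ominus(B,\mathbb{M}))\subseteq\mathrm{Mod}(B)$; (vacuity) if $\mathbb{M}\cap\mathrm{Mod}(B)=\emptyset$ then $\mathrm{Mod}(\ominus(B,\mathbb{M}))=\mathrm{Mod}(B)$; (finite retainment) if $\mathrm{Mod}(\ominus(B,\mathbb{M}))\subsetneq \mathbb{M}''\subseteq\mathrm{Mod}(B)\setminus\mathbb{M}$ then $\mathbb{M}''\notin\mathrm{FR}(\Lambda)$; (uniformity) if $\mathrm{FRsubs}(\mathrm{Mod}(B)\setminus\mathbb{M},\Lambda)=\mathrm{FRsubs}(\mathrm{Mod}(B')\setminus\mathbb{M}',\Lambda)$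 then $\mathrm{Mod}(\ominus(B,\mathbb{M}))=\mathrm{Mod}(\ominus(B',\mathbb{M}'))$.
   Context: A satisfaction system is a triple $\Lambda=(\mathcal{L},\mathfrak{M},\models)$ where $\mathcal{L}$ is a set of formulae, $\mathfrak{M}$ a set of models, and $\models$ a relation between models and sets of formulae $B\subseteq\mathcal{L}$. $\mathrm{Mod}(B)=\{m\in\mathfrak{M}\mid m\models B\}$. $\mathcal{P}(A)$ is the power set of $A$, $\mathcal{P}_{\mathrm{fin}}(A)$ the set of finite subsets of $A$. $\mathrm{FR}(\Lambda)=\{X\subseteq\mathfrak{M}\mid X=\mathrm{Mod}(B)$ for some $B\in\mathcal{P}_{\mathrm{fin}}(\mathcal{L})\}$. For $\mathbb{M}\subseteq\mathfrak{M}$, $\mathrm{FRsubs}(\mathbb{M},\Lambda)=\{X\in\mathrm{FR}(\Lambda)\mid X\subseteq\mathbb{M}$ and there is no $Y\in\mathrm{FR}(\Lambda)$ with $X\subsetneq Y\subseteq\mathbb{M}\}$. $\Lambda$ is eviction-compatible if $\mathrm{FRsubs}(\mathrm{Mod}(B)\setminus\mathbb{M},\Lambda)\neq\emptyset$ for all $B\in\mathcal{P}_{\mathrm{fin}}(\mathcal{L})$ and $\mathbb{M}\subseteq\mathfrak{M}$. A model change operation is any function $\mathcal{P}_{\mathrm{fin}}(\mathcal{L})\times\mathcal{P}(\mathfrak{M})\to\mathcal{P}_{\mathrm{fin}}(\mathcal{L})$. A selection function on $\Lambda$ is a map $\gamma$ from the nonempty subsets of $\mathrm{FR}(\Lambda)$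 to $\mathrm{FR}(\Lambda)$ with $\gamma(X)\in X$ for every nonempty $X\subseteq\mathrm{FR}(\Lambda)$. -}

module Defs where

open import Data.List using (List)
open import Data.List.Membership.Propositional using (_∈_)
open import Data.Product using (Σ; _×_; _,_; proj₁; proj₂)
open import Data.Sum using (_⊎_)
open import Relation.Nullary using (¬_)

record SatSystem : Set₁ where
  field
    Formula : Set
    Model   : Set
    _⊨_     : Model → (Formula → Set) → Set

module _ (Λ : SatSystem) where
  open SatSystem Λ

  ℙM : Set₁
  ℙM = Model → Set

  -- finite subsets of 𝓛, represented by lists (the set is the list's membership)
  FinSub : Set
  FinSub = List Formula

  ⟦_⟧ : FinSub → Formula → Set
  ⟦ B ⟧ φ = φ ∈ B

  Mod : FinSub → ℙM
  Mod B m = m ⊨ ⟦ B ⟧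

  _⊆_ : ℙM → ℙM → Set
  X ⊆ Y = ∀ m → X m → Y m

  _≐_ : ℙM → ℙM → Set
  X ≐ Y = X ⊆ Y × Y ⊆ X

  _⊊_ : ℙM → ℙM → Set
  X ⊊ Y = X ⊆ Y × ¬ (Y ⊆ X)

  _∖_ : ℙM → ℙM → ℙM
  (X ∖ Y) m = X m × ¬ Y m

  _∩_ : ℙM → ℙM → ℙM
  (X ∩ Y) m = X m × Y m

  IsEmpty : ℙM → Set
  IsEmpty X = ∀ m → ¬ X m

  InFR : ℙM → Set
  InFR X = Σ FinSub λ B → X ≐ Mod B

  -- sets of sets of models (membership taken up to ≐, see _∈ᶠ_)
  Fam : Set₂
  Fam = ℙM → Set₁

  _∈ᶠ_ : ℙM → Fam → Set₁
  Y ∈ᶠ X = Σ ℙM λ Y' → Y' ≐ Y × X Y'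

  _≈ᶠ_ : Fam → Fam → Set₁
  X ≈ᶠ X' = ∀ Y → (Y ∈ᶠ X → Y ∈ᶠ X') × (Y ∈ᶠ X' → Y ∈ᶠ X)

  SubFR : Fam → Set₁
  SubFR X = ∀ Y → Y ∈ᶠ X → InFR Y

  NonEmpty : Fam → Set₁
  NonEmpty X = Σ ℙM λ Y → Y ∈ᶠ X

  FRsubs : ℙM → Fam
  FRsubs A Y = InFR Y × Y ⊆ A × ¬ (Σ ℙM λ Z → InFR Z × Y ⊊ Z × Z ⊆ A)

  EvictionCompatible : Set₁
  EvictionCompatible = ∀ B (M : ℙM) → NonEmpty (FRsubs (Mod B ∖ M))

  ModelChange : Set₁
  ModelChange = FinSub → ℙM → FinSub

  SelFun : Set₂
  SelFun = (X : Fam) → SubFR X → NonEmpty X → ℙM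

  IsSelection : SelFun → Set₂
  IsSelection γ =
    (∀ X p n → γ X p n ∈ᶠ X) ×
    (∀ X X' p n p' n' → X ≈ᶠ X' → γ X p n ≐ γ X' p' n')

  private
    ⊆-trans : ∀ {X Y Z} → X ⊆ Y → Y ⊆ Z → X ⊆ Z
    ⊆-trans p q m x = q m (p m x)

  FRsubs-SubFR : ∀ A → SubFR (FRsubs A)
  FRsubs-SubFR A Y (Y' , (a , b) , (B , (c , d)) , _) =
    B , (⊆-trans b c , ⊆-trans d a)

  MaxichoiceEviction : EvictionCompatible → ModelChange → Set₂
  MaxichoiceEviction ec ⊖ =
    Σ SelFun λ γ → IsSelection γ ×
      (∀ B M → Mod (⊖ B M) ≐ γ (FRsubs (Mod B ∖ M)) (FRsubs-SubFR _) (ec B M))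

  Success Inclusion Vacuity FiniteRetainment : ModelChange → Set₁
  Success ⊖ = ∀ B M → IsEmpty (M ∩ Mod (⊖ B M))
  Inclusion ⊖ = ∀ B (M : ℙM) → Mod (⊖ B M) ⊆ Mod B
  Vacuity ⊖ = ∀ B M → IsEmpty (M ∩ Mod B) → Mod (⊖ B M) ≐ Mod B
  FiniteRetainment ⊖ = ∀ B M M'' →
    Mod (⊖ B M) ⊊ M'' → M'' ⊆ (Mod B ∖ M) → ¬ InFR M''

  Uniformity : ModelChange → Set₁
  Uniformity ⊖ = ∀ B M B' M' →
    FRsubs (Mod B ∖ M) ≈ᶠ FRsubs (Mod B' ∖ M') → Mod (⊖ B M) ≐ Mod (⊖ B' M')

  -- Classical metatheory of the paper (ZFC), made explicit:
  -- choice function on all nonempty sets of subsets of 𝔐.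
  FamilyChoice : Set₂
  FamilyChoice = Σ ((X : Fam) → NonEmpty X → ℙM) λ ε →
    (∀ X n → ε X n ∈ᶠ X) ×
    (∀ X X' n n' → X ≈ᶠ X' → ε X n ≐ ε X' n')

LEM₁ : Set₂
LEM₁ = (P : Set₁) → P ⊎ ¬ P

{-# OPTIONS --safe #-}
-- A maxichoice eviction function picks, for each (B, 𝕄), some maximal finitely representable
-- subset of Mod B ∖ 𝕄.  Success, inclusion and finite retainment say precisely that
-- Mod (⊖ B 𝕄) is such a maximal subset; vacuity is then automatic, because a finitely
-- representable set is its own unique maximal subset.  Uniformity says that this choice
-- depends only on the family FRsubs(Mod B ∖ 𝕄), so it extends, by choice on the remaining
-- families, to a selection function.
module Submission where

open import Defs
open import Data.Empty using (⊥-elim)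
open import Data.Product using (Σ; _×_; _,_; proj₁; proj₂)
open import Data.Sum using (_⊎_; inj₁; inj₂)
open import Level using (Lift; lift)
open import Relation.Nullary using (¬_)

module _ (Λ : SatSystem) where
  private
    infix 4 _⊆′_ _≐′_ _∈′_ _≈′_
    infixl 6 _∖′_
    _⊆′_ : ℙM Λ → ℙM Λ → Set
    _⊆′_ = _⊆_ Λ
    _≐′_ : ℙM Λ → ℙM Λ → Set
    _≐′_ = _≐_ Λ
    _∈′_ : ℙM Λ → Fam Λ → Set₁
    _∈′_ = _∈ᶠ_ Λ
    _≈′_ : Fam Λ → Fam Λ → Set₁
    _≈′_ = _≈ᶠ_ Λ
    _∖′_ : ℙM Λ → ℙM Λ → ℙM Λ
    _∖′_ = _∖_ Λ

  ≐-refl : ∀ {X} → X ≐′ X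
  ≐-refl = (λ _ x → x) , (λ _ x → x)

  ≐-sym : ∀ {X Y} → X ≐′ Y → Y ≐′ X
  ≐-sym (X⊆Y , Y⊆X) = Y⊆X , X⊆Y

  ≐-trans : ∀ {X Y Z} → X ≐′ Y → Y ≐′ Z → X ≐′ Z
  ≐-trans (X⊆Y , Y⊆X) (Y⊆Z , Z⊆Y) = (λ m x → Y⊆Z m (X⊆Y m x)) , (λ m z → Y⊆X m (Z⊆Y m z))

  ≈ᶠ-refl : ∀ {X} → X ≈′ X
  ≈ᶠ-refl Y = (λ y → y) , (λ y → y)

  ≈ᶠ-sym : ∀ {X X'} → X ≈′ X' → X' ≈′ X
  ≈ᶠ-sym e Y = proj₂ (e Y) , proj₁ (e Y)

  ≈ᶠ-trans : ∀ {X X' X''} → X ≈′ X' → X' ≈′ X'' → X ≈′ X''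
  ≈ᶠ-trans e f Y = (λ y → proj₁ (f Y) (proj₁ (e Y) y)) , (λ y → proj₂ (e Y) (proj₂ (f Y) y))

  InFR-resp-≐ : ∀ {X Y} → X ≐′ Y → InFR Λ X → InFR Λ Y
  InFR-resp-≐ X≐Y (B , X≐ModB) = B , ≐-trans (≐-sym X≐Y) X≐ModB

  FRsubs-resp-≐ : ∀ {A X Y} → X ≐′ Y → FRsubs Λ A X → FRsubs Λ A Y
  FRsubs-resp-≐ {A} {Y = Y} (X⊆Y , Y⊆X) (X∈FR , X⊆A , X-maximal) =
    InFR-resp-≐ (X⊆Y , Y⊆X) X∈FR , (λ m y → X⊆A m (Y⊆X m y)) , Y-maximal
    where
    Y-maximal : ¬ (Σ (ℙM Λ) λ Z → InFR Λ Z × _⊊_ Λ Y Z × Z ⊆′ A)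
    Y-maximal (Z , Z∈FR , (Y⊆Z , Z⊈Y) , Z⊆A) =
      X-maximal (Z , Z∈FR , ((λ m x → Y⊆Z m (X⊆Y m x)) , (λ Z⊆X → Z⊈Y (λ m z → X⊆Y m (Z⊆X m z)))) , Z⊆A)

  ∈ᶠ-FRsubs : ∀ {A Y} → Y ∈′ FRsubs Λ A → FRsubs Λ A Y
  ∈ᶠ-FRsubs (Y' , Y'≐Y , Y'∈FRsubs) = FRsubs-resp-≐ Y'≐Y Y'∈FRsubs

  -- Classically, a maximal finitely representable subset Y of a finitely representable A
  -- must be A itself, since otherwise A would properly extend Y.
  FRsubs-of-InFR : LEM₁ → ∀ {A Y} → InFR Λ A → FRsubs Λ A Y → Y ≐′ A
  FRsubs-of-InFR lem {A} {Y} A∈FR (_ , Y⊆A , Y-maximal) with lem (Lift _ (A ⊆′ Y))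
  ... | inj₁ (lift A⊆Y) = Y⊆A , A⊆Y
  ... | inj₂ A⊈Y = ⊥-elim (Y-maximal (A , A∈FR , (Y⊆A , λ A⊆Y → A⊈Y (lift A⊆Y)) , λ _ a → a))

  -- γ follows s on families of the form F i, and the global choice function everywhere else.
  extendSelection : LEM₁ → FamilyChoice Λ → {I : Set₁} (F : I → Fam Λ) (s : I → ℙM Λ) →
    (∀ i → s i ∈′ F i) → (∀ i j → F i ≈′ F j → s i ≐′ s j) →
    Σ (SelFun Λ) λ γ → IsSelection Λ γ × (∀ i p n → s i ≐′ γ (F i) p n)
  extendSelection lem (ε , ε-selects , ε-resp) {I} F s s-selects s-resp =
    γ , (γ-selects , γ-resp) , γ-extends
    where
    InImage : Fam Λ → Set₁
    InImage X = Σ I λ i → X ≈′ F i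

    select : (X : Fam Λ) → NonEmpty Λ X → InImage X ⊎ ¬ InImage X → ℙM Λ
    select X n (inj₁ (i , _)) = s i
    select X n (inj₂ _)       = ε X n

    γ : SelFun Λ
    γ X _ n = select X n (lem (InImage X))

    select-selects : ∀ X n d → select X n d ∈′ X
    select-selects X n (inj₁ (i , X≈Fi)) = proj₂ (X≈Fi _) (s-selects i)
    select-selects X n (inj₂ _)          = ε-selects X n

    select-resp : ∀ X X' n n' d d' → X ≈′ X' → select X n d ≐′ select X' n' d'
    select-resp X X' n n' (inj₁ (i , X≈Fi)) (inj₁ (j , X'≈Fj)) X≈X' =
      s-resp i j (≈ᶠ-trans (≈ᶠ-sym X≈Fi) (≈ᶠ-trans X≈X' X'≈Fj))
    select-resp X X' n n' (inj₁ (i , X≈Fi)) (inj₂ X'∉) X≈X' = ⊥-elim (X'∉ (i , ≈ᶠ-trans (≈ᶠ-sym X≈X') X≈Fi))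
    select-resp X X' n n' (inj₂ X∉) (inj₁ (j , X'≈Fj)) X≈X' = ⊥-elim (X∉ (j , ≈ᶠ-trans X≈X' X'≈Fj))
    select-resp X X' n n' (inj₂ _) (inj₂ _) X≈X' = ε-resp X X' n n' X≈X'

    γ-selects : ∀ X p n → γ X p n ∈′ X
    γ-selects X _ n = select-selects X n (lem (InImage X))

    γ-resp : ∀ X X' p n p' n' → X ≈′ X' → γ X p n ≐′ γ X' p' n'
    γ-resp X X' _ n _ n' = select-resp X X' n n' (lem (InImage X)) (lem (InImage X'))

    select-extends : ∀ i n d → s i ≐′ select (F i) n d
    select-extends i n (inj₁ (j , Fi≈Fj)) = s-resp i j Fi≈Fj
    select-extends i n (inj₂ Fi∉) = ⊥-elim (Fi∉ (i , ≈ᶠ-refl))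

    γ-extends : ∀ i p n → s i ≐′ γ (F i) p n
    γ-extends i _ n = select-extends i n (lem (InImage (F i)))

  module _ (⊖ : ModelChange Λ) where

    SelectsFRsub : Set₁
    SelectsFRsub = ∀ B M → FRsubs Λ (Mod Λ B ∖′ M) (Mod Λ (⊖ B M))

    selectsFRsub⇒success : SelectsFRsub → Success Λ ⊖
    selectsFRsub⇒success sel B M m (m∈M , m∈Mod⊖) = proj₂ (proj₁ (proj₂ (sel B M)) m m∈Mod⊖) m∈M

    selectsFRsub⇒inclusion : SelectsFRsub → Inclusion Λ ⊖
    selectsFRsub⇒inclusion sel B M m m∈Mod⊖ = proj₁ (proj₁ (proj₂ (sel B M)) m m∈Mod⊖)

    selectsFRsub⇒vacuity : LEM₁ → SelectsFRsub → Vacuity Λ ⊖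
    selectsFRsub⇒vacuity lem sel B M M∩ModB-empty =
      ≐-trans (FRsubs-of-InFR lem (B , ModB∖M≐ModB) (sel B M)) ModB∖M≐ModB
      where
      ModB∖M≐ModB : Mod Λ B ∖′ M ≐′ Mod Λ B
      ModB∖M≐ModB = (λ _ → proj₁) , (λ m m∈ModB → m∈ModB , λ m∈M → M∩ModB-empty m (m∈M , m∈ModB))

    selectsFRsub⇒finiteRetainment : SelectsFRsub → FiniteRetainment Λ ⊖
    selectsFRsub⇒finiteRetainment sel B M M'' Mod⊖⊊M'' M''⊆ModB∖M M''∈FR =
      proj₂ (proj₂ (sel B M)) (M'' , M''∈FR , Mod⊖⊊M'' , M''⊆ModB∖M)

    success∧inclusion∧retainment⇒selectsFRsub : Success Λ ⊖ → Inclusion Λ ⊖ → FiniteRetainment Λ ⊖ → SelectsFRsub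
    success∧inclusion∧retainment⇒selectsFRsub success inclusion retainment B M =
      (⊖ B M , ≐-refl) ,
      (λ m m∈Mod⊖ → inclusion B M m m∈Mod⊖ , λ m∈M → success B M m (m∈M , m∈Mod⊖)) ,
      λ { (Z , Z∈FR , Mod⊖⊊Z , Z⊆ModB∖M) → retainment B M Z Mod⊖⊊Z Z⊆ModB∖M Z∈FR }

    module _ (ec : EvictionCompatible Λ) where

      maxichoice⇒selectsFRsub : MaxichoiceEviction Λ ec ⊖ → SelectsFRsub
      maxichoice⇒selectsFRsub (γ , (γ-selects , _) , Mod⊖≐γ) B M =
        FRsubs-resp-≐ (≐-sym (Mod⊖≐γ B M)) (∈ᶠ-FRsubs (γ-selects _ (FRsubs-SubFR Λ _) (ec B M)))

      maxichoice⇒uniformity : MaxichoiceEviction Λ ec ⊖ → Uniformity Λ ⊖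
      maxichoice⇒uniformity (γ , (_ , γ-resp) , Mod⊖≐γ) B M B' M' same-FRsubs =
        ≐-trans (Mod⊖≐γ B M)
          (≐-trans (γ-resp _ _ (FRsubs-SubFR Λ _) (ec B M) (FRsubs-SubFR Λ _) (ec B' M') same-FRsubs)
                   (≐-sym (Mod⊖≐γ B' M')))

      selectsFRsub⇒maxichoice : LEM₁ → FamilyChoice Λ →
        SelectsFRsub → Uniformity Λ ⊖ → MaxichoiceEviction Λ ec ⊖
      selectsFRsub⇒maxichoice lem choice sel uniformity
        with extendSelection lem choice
               (λ ((B , M) : FinSub Λ × ℙM Λ) → FRsubs Λ (Mod Λ B ∖′ M))
               (λ (B , M) → Mod Λ (⊖ B M))
               (λ (B , M) → _ , ≐-refl , sel B M)
               (λ (B , M) (B' , M') → uniformity B M B' M')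
      ... | γ , γ-selection , γ-extends = γ , γ-selection , λ B M → γ-extends (B , M) _ (ec B M)

theorem1 : LEM₁ → (Λ : SatSystem) → FamilyChoice Λ →
    (ec : EvictionCompatible Λ) (⊖ : ModelChange Λ) →
    (MaxichoiceEviction Λ ec ⊖ →
      Success Λ ⊖ × Inclusion Λ ⊖ × Vacuity Λ ⊖ × FiniteRetainment Λ ⊖ × Uniformity Λ ⊖)
    × (Success Λ ⊖ × Inclusion Λ ⊖ × Vacuity Λ ⊖ × FiniteRetainment Λ ⊖ × Uniformity Λ ⊖ →
      MaxichoiceEviction Λ ec ⊖)
theorem1 lem Λ choice ec ⊖ = forward , backward
  where
  Postulates : Set₁
  Postulates = Success Λ ⊖ × Inclusion Λ ⊖ × Vacuity Λ ⊖ × FiniteRetainment Λ ⊖ × Uniformity Λ ⊖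

  forward : MaxichoiceEviction Λ ec ⊖ → Postulates
  forward maxichoice =
    selectsFRsub⇒success Λ ⊖ sel , selectsFRsub⇒inclusion Λ ⊖ sel ,
    selectsFRsub⇒vacuity Λ ⊖ lem sel , selectsFRsub⇒finiteRetainment Λ ⊖ sel ,
    maxichoice⇒uniformity Λ ⊖ ec maxichoice
    where
    sel : SelectsFRsub Λ ⊖
    sel = maxichoice⇒selectsFRsub Λ ⊖ ec maxichoice

  backward : Postulates → MaxichoiceEviction Λ ec ⊖
  backward (success , inclusion , _ , retainment , uniformity) =
    selectsFRsub⇒maxichoice Λ ⊖ ec lem choice
      (success∧inclusion∧retainment⇒selectsFRsub Λ ⊖ success inclusion retainment) uniformity
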